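{- Consider an instance of fair $k$-center: a finite metric space $(X,d)$ with $|X|=n$, a group assignment $g:X\to\{1,\dots,m\}$, and capacities $k_1,\dots,k_m$ with $k=\sum_j k_j$. Let $\mathrm{OPT}$ be the minimum clustering cost for $X$ of a feasible set, and let $\tau\ge \mathrm{OPT}$. Run the following two-pass algorithm: (1) (Pass 1) Compute $P$ by scanning $X$ in an arbitrary order, starting with $P$ containing the first point, and adding each scanned point $q$ to $P$ whenever $\min_{p\in P} d(p,q)>2\tau$. (2) (Pass 2) For each $q\in P$, initialize $N(q)=\{q\}$; scan $X$ in an arbitrary order and, for each scanned point $x$ and each $q\in P$, add $x$ to $N(q)$ if $d(q,x)\le\tau$ and $N(q)$ does not yet contain a point of group $g(x)$. (3) Output a feasible set $S\subseteq\bigcup_{q\in P}N(q)$ which intersects the maximum possible number of the sets $N(q)$, $q\in P$, among all feasible subsets of $\bigcup_{q\in P}N(q)$. Then the output $S$ is feasible and its clustering cost for $X$ is at most $3\tau$. In particular, if $\tau\in[\mathrm{OPT},(1+\varepsilon)\mathrm{OPT}]$ for some $\varepsilon>0$, the output is a $3(1+\varepsilon)$-approximation.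
   Context: For nonempty $A,B\subseteq X$, the clustering cost of $A$ for $B$ is $\max_{b\in B}\min_{a\in A}d(a,b)$. A set $S\subseteq X$ is feasible if for every group $j$ it contains at most $k_j$ points $x$ with $g(x)=j$. The fair $k$-center problem asks for a feasible set of minimum clustering cost for $X$; this minimum is denoted $\mathrm{OPT}$.
   Formalization: The metric d takes rational values, and the threshold τ, the optimum OPT and the parameter ε are likewise rational. -}

module Defs where

open import Data.Nat as ℕ using (ℕ)
open import Data.Fin using (Fin; _≟_)
open import Data.Fin.Subset using (Subset; ∣_∣; _∩_)
open import Data.Vec using (tabulate; lookup)
open import Data.Bool using (Bool; true; false; if_then_else_; not)
open import Data.List using (List; []; _∷_; _++_; filter; length; allFin)
open import Data.Bool.ListAction using (any; all)
open import Data.List.Membership.Propositional using (_∈_)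
open import Data.Product using (Σ; ∃; _×_; _,_)
open import Data.Rational using (ℚ; _≤_; _<_; _+_; 0ℚ)
open import Data.Rational.Properties using (_≤?_; _<?_)
open import Relation.Nullary using (does)
open import Relation.Binary.PropositionalEquality using (_≡_)

record IsMetric {n : ℕ} (d : Fin n → Fin n → ℚ) : Set where
  field
    nonneg   : ∀ x y → 0ℚ ≤ d x y
    zero-iff : ∀ x y → d x y ≡ 0ℚ → x ≡ y
    refl0    : ∀ x → d x x ≡ 0ℚ
    symm     : ∀ x y → d x y ≡ d y x
    triangle : ∀ x y z → d x z ≤ d x y + d y z

module FairKCenter
  {n m : ℕ} (d : Fin n → Fin n → ℚ) (g : Fin n → Fin m) (k : Fin m → ℕ) where

  X : Subset n
  X = tabulate (λ _ → true)

  group : Fin m → Subset n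
  group j = tabulate (λ x → does (g x ≟ j))

  Feasible : Subset n → Set
  Feasible S = ∀ j → ∣ S ∩ group j ∣ ℕ.≤ k j

  _∈ˢ_ : Fin n → Subset n → Set
  x ∈ˢ S = lookup S x ≡ true

  IsMinDist : Subset n → Fin n → ℚ → Set
  IsMinDist A b c = (∃ λ a → a ∈ˢ A × d a b ≡ c) × (∀ a → a ∈ˢ A → c ≤ d a b)

  IsCost : Subset n → Subset n → ℚ → Set
  IsCost A B c = (∃ λ b → b ∈ˢ B × IsMinDist A b c)
               × (∀ b → b ∈ˢ B → ∀ c' → IsMinDist A b c' → c' ≤ c)

  IsOPT : ℚ → Set
  IsOPT opt = (∃ λ S → Feasible S × IsCost S X opt)
            × (∀ S c → Feasible S → IsCost S X c → opt ≤ c)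

  farFrom : ℚ → List (Fin n) → Fin n → Bool
  farFrom τ P q = all (λ p → does ((τ + τ) <? d p q)) P

  pass1-go : ℚ → List (Fin n) → List (Fin n) → List (Fin n)
  pass1-go τ P []       = P
  pass1-go τ P (q ∷ qs) =
    pass1-go τ (if farFrom τ P q then P ++ (q ∷ []) else P) qs

  pass1 : ℚ → List (Fin n) → List (Fin n)
  pass1 τ []       = []
  pass1 τ (x ∷ xs) = pass1-go τ (x ∷ []) xs

  hasGroup : List (Fin n) → Fin m → Bool
  hasGroup N j = any (λ y → does (g y ≟ j)) N

  pass2-go : ℚ → Fin n → List (Fin n) → List (Fin n) → List (Fin n)
  pass2-go τ q N []       = N
  pass2-go τ q N (x ∷ xs) =
    pass2-go τ q
      (if does (d q x ≤? τ) Data.Bool.∧ not (hasGroup N (g x))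
         then N ++ (x ∷ []) else N) xs

  N : ℚ → List (Fin n) → Fin n → List (Fin n)
  N τ σ q = pass2-go τ q (q ∷ []) σ

  ⊆Union : List (Fin n) → (Fin n → List (Fin n)) → Subset n → Set
  ⊆Union P Nq S = ∀ x → x ∈ˢ S → ∃ λ q → q ∈ P × x ∈ Nq q

  hits : List (Fin n) → (Fin n → List (Fin n)) → Subset n → ℕ
  hits P Nq S = length (filter (λ q → any (λ x → lookup S x) (Nq q) Data.Bool.≟ true) P)

  IsOutput : List (Fin n) → (Fin n → List (Fin n)) → Subset n → Set
  IsOutput P Nq S = Feasible S × ⊆Union P Nq S
                  × (∀ S' → Feasible S' → ⊆Union P Nq S' → hits P Nq S' ℕ.≤ hits P Nq S)

{-# OPTIONS --safe #-}

-- Pass 1 yields centres P that are pairwise more than 2τ apart and cover X within 2τ.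
-- Since OPT ≤ τ, every q ∈ P has an optimal centre s(q) within τ, and separation makes
-- s injective on P.  Pass 2 puts into N(q) a point y(q) of the same group as s(q), so
-- {y(q) | q ∈ P} uses no more points of any group than the optimal solution: it is a
-- feasible set meeting every N(q).  An output meeting the maximum number of the N(q)
-- therefore meets all of them, and every point is within 2τ + τ of it.

module Submission where

open import Defs
open import Data.Nat using (ℕ)
open import Data.Fin using (Fin)
open import Data.Fin.Subset using (Subset)
open import Data.List using (List; allFin)
open import Data.List.Relation.Binary.Permutation.Propositional using (_↭_)
open import Data.Product using (∃; _×_)
open import Data.Rational using (ℚ; _≤_; _<_; _+_; _*_; 0ℚ; 1ℚ)

open import Data.Nat as ℕ using (suc; z≤n; s≤s)
import Data.Nat.Properties as ℕₚ
open import Data.Fin using (zero; suc; _≟_)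
open import Data.Fin.Subset as Sub using (∣_∣; _∩_; _∪_; _-_; ⁅_⁆; ⋃; inside; outside)
open import Data.Fin.Subset.Properties
  using (_∈?_; ∉⊥; ∣⊥∣≡0; x∈⁅x⁆; x∈⁅y⁆⇒x≡y; p⊆q⇒∣p∣≤∣q∣; p⊆p∪q; q⊆p∪q; x∈p∪q⁻; ∪-identityˡ;
         x∈p∩q⁺; x∈p∩q⁻; x∈p∧x≢y⇒x∈p-y; x∈p⇒∣p-x∣<∣p∣; ∣p∣≤∣x∷p∣)
open import Data.Vec using (_∷_; here; there; lookup)
open import Data.Vec.Properties using (lookup∘tabulate; lookup⇒[]=; []=⇒lookup)
open import Data.Bool as Bool using (Bool; true; false; T)
open import Data.Bool.Properties using (T-≡)
open import Data.Bool.ListAction using (any; all)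
open import Data.List using ([]; _∷_; _++_; length; filter; map)
open import Data.List.Properties using (length-map; filter-all; filter-notAll)
open import Data.List.Relation.Unary.Any as Any using (Any; here; there)
open import Data.List.Relation.Unary.Any.Properties using (any⁺; any⁻)
open import Data.List.Relation.Unary.All as All using (All; []; _∷_)
open import Data.List.Relation.Unary.All.Properties using (all⁺; all⁻; ¬All⇒Any¬)
import Data.List.Relation.Unary.All.Properties as All
open import Data.List.Relation.Unary.AllPairs as AllPairs using (AllPairs; []; _∷_)
import Data.List.Relation.Unary.AllPairs.Properties as AllPairs
open import Data.List.Relation.Unary.Unique.Propositional using (Unique)
open import Data.List.Membership.Propositional using (_∈_; find; lose)
open import Data.List.Membership.Propositional.Properties
  using (∈-allFin; ∈-++⁺ˡ; ∈-++⁺ʳ; ∈-filter⁺; ∈-filter⁻; ∈-map⁺; ∈-map⁻)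
open import Data.List.Relation.Binary.Permutation.Propositional using (↭-sym)
open import Data.List.Relation.Binary.Permutation.Propositional.Properties using (∈-resp-↭)
open import Data.Product using (_,_; proj₁; proj₂)
open import Data.Sum using (inj₁; inj₂)
open import Data.Rational.Properties as ℚₚ using (_≤?_; _<?_)
open import Relation.Binary.Bundles using (DecTotalOrder)
open import Data.List.Extrema (DecTotalOrder.totalOrder ℚₚ.≤-decTotalOrder)
  using (argmin; argmax; argmin-all; argmax-all; f[argmin]≤f[xs]; f[xs]≤f[argmax])
open import Function using (_∘_; Equivalence)
open import Relation.Binary.PropositionalEquality
  using (_≡_; _≢_; refl; sym; trans; cong; cong₂; subst; module ≡-Reasoning)
open import Relation.Nullary using (¬_; Dec; yes; no; does; contradiction)
open import Relation.Nullary.Decidable using (dec-true; decidable-stable)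
open import Relation.Unary using (Decidable)

private
  variable
    n : ℕ

toSubset : List (Fin n) → Subset n
toSubset xs = ⋃ (map ⁅_⁆ xs)

∈-toSubset⁺ : ∀ {x} {xs : List (Fin n)} → x ∈ xs → x Sub.∈ toSubset xs
∈-toSubset⁺ {x = x} {_ ∷ xs} (here refl) = p⊆p∪q (toSubset xs) (x∈⁅x⁆ x)
∈-toSubset⁺ {xs = y ∷ xs}    (there x∈xs) = q⊆p∪q ⁅ y ⁆ (toSubset xs) (∈-toSubset⁺ x∈xs)

∈-toSubset⁻ : ∀ {x} (xs : List (Fin n)) → x Sub.∈ toSubset xs → x ∈ xs
∈-toSubset⁻ []       x∈⊥ = contradiction x∈⊥ ∉⊥
∈-toSubset⁻ (y ∷ xs) x∈  with x∈p∪q⁻ ⁅ y ⁆ (toSubset xs) x∈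
... | inj₁ x∈⁅y⁆  = here (x∈⁅y⁆⇒x≡y y x∈⁅y⁆)
... | inj₂ x∈xs   = there (∈-toSubset⁻ xs x∈xs)

∣⁅x⁆∪p∣≤suc∣p∣ : ∀ x (p : Subset n) → ∣ ⁅ x ⁆ ∪ p ∣ ℕ.≤ suc ∣ p ∣
∣⁅x⁆∪p∣≤suc∣p∣ zero    (b ∷ p) rewrite ∪-identityˡ p = s≤s (∣p∣≤∣x∷p∣ b p)
∣⁅x⁆∪p∣≤suc∣p∣ (suc x) (inside  ∷ p) = s≤s (∣⁅x⁆∪p∣≤suc∣p∣ x p)
∣⁅x⁆∪p∣≤suc∣p∣ (suc x) (outside ∷ p) = ∣⁅x⁆∪p∣≤suc∣p∣ x p

∣toSubset∣≤length : ∀ (xs : List (Fin n)) → ∣ toSubset xs ∣ ℕ.≤ length xs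
∣toSubset∣≤length {n} []       = ℕₚ.≤-reflexive (∣⊥∣≡0 n)
∣toSubset∣≤length (x ∷ xs) =
  ℕₚ.≤-trans (∣⁅x⁆∪p∣≤suc∣p∣ x (toSubset xs)) (s≤s (∣toSubset∣≤length xs))

p⊆xs⇒∣p∣≤length : ∀ {p : Subset n} xs → (∀ {x} → x Sub.∈ p → x ∈ xs) → ∣ p ∣ ℕ.≤ length xs
p⊆xs⇒∣p∣≤length xs p⊆xs = ℕₚ.≤-trans (p⊆q⇒∣p∣≤∣q∣ (∈-toSubset⁺ ∘ p⊆xs)) (∣toSubset∣≤length xs)

xs⊆p⇒length≤∣p∣ : ∀ {p : Subset n} {xs} → Unique xs → (∀ {x} → x ∈ xs → x Sub.∈ p) →
                  length xs ℕ.≤ ∣ p ∣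
xs⊆p⇒length≤∣p∣ []               _    = z≤n
xs⊆p⇒length≤∣p∣ {p = p} {y ∷ xs} (y∉xs ∷ xs!) xs⊆p =
  ℕₚ.≤-trans (s≤s (xs⊆p⇒length≤∣p∣ xs! xs⊆p-y)) (x∈p⇒∣p-x∣<∣p∣ (xs⊆p (here refl)))
  where
  xs⊆p-y : ∀ {x} → x ∈ xs → x Sub.∈ p - y
  xs⊆p-y x∈xs = x∈p∧x≢y⇒x∈p-y (xs⊆p (there x∈xs)) (λ x≡y → All.lookup y∉xs x∈xs (sym x≡y))

elements : Subset n → List (Fin n)
elements p = filter (_∈? p) (allFin _)

∈-elements⁺ : ∀ {p : Subset n} {x} → x Sub.∈ p → x ∈ elements p
∈-elements⁺ {p = p} {x} x∈p = ∈-filter⁺ (_∈? p) (∈-allFin x) x∈p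

∈-elements⁻ : ∀ {p : Subset n} {x} → x ∈ elements p → x Sub.∈ p
∈-elements⁻ {n} {p} = proj₂ ∘ ∈-filter⁻ (_∈? p) {xs = allFin n}

module _ (f : Fin n → ℚ) {p : Subset n} {x₀ : Fin n} (x₀∈p : x₀ Sub.∈ p) where

  minimiser : ∃ λ a → a Sub.∈ p × (∀ {b} → b Sub.∈ p → f a ≤ f b)
  minimiser = argmin f x₀ (elements p)
            , argmin-all f x₀∈p (All.tabulate ∈-elements⁻)
            , All.lookup (f[argmin]≤f[xs] x₀ (elements p)) ∘ ∈-elements⁺

  maximiser : ∃ λ a → a Sub.∈ p × (∀ {b} → b Sub.∈ p → f b ≤ f a)
  maximiser = argmax f x₀ (elements p)
            , argmax-all f x₀∈p (All.tabulate ∈-elements⁻)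
            , All.lookup (f[xs]≤f[argmax] x₀ (elements p)) ∘ ∈-elements⁺

does-true⁻ : ∀ {p} {P : Set p} (P? : Dec P) → does P? ≡ true → P
does-true⁻ (yes p) _  = p
does-true⁻ (no _)  ()

private
  T⇒≡true : ∀ {b} → T b → b ≡ true
  T⇒≡true = Equivalence.to T-≡

  ≡true⇒T : ∀ {b} → b ≡ true → T b
  ≡true⇒T = Equivalence.from T-≡

module _ {a} {A : Set a} (f : A → Bool) where

  any≡true⁺ : ∀ {x xs} → x ∈ xs → f x ≡ true → any f xs ≡ true
  any≡true⁺ x∈xs fx = T⇒≡true (any⁺ f (lose x∈xs (≡true⇒T fx)))

  any≡true⁻ : ∀ xs → any f xs ≡ true → ∃ λ x → x ∈ xs × f x ≡ true
  any≡true⁻ xs e = find (Any.map T⇒≡true (any⁻ f xs (≡true⇒T e)))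

module _ {a p} {A : Set a} {P : A → Set p} (P? : Decidable P) where

  any-does⁻ : ∀ xs → any (does ∘ P?) xs ≡ true → ∃ λ x → x ∈ xs × P x
  any-does⁻ xs e with any≡true⁻ (does ∘ P?) xs e
  ... | x , x∈xs , Px = x , x∈xs , does-true⁻ (P? x) Px

  all-does⁻ : ∀ xs → all (does ∘ P?) xs ≡ true → All P xs
  all-does⁻ xs e = All.map (λ {x} → does-true⁻ (P? x) ∘ T⇒≡true) (all⁺ (does ∘ P?) xs (≡true⇒T e))

  all-does-false⁻ : ∀ xs → all (does ∘ P?) xs ≡ false → ∃ λ x → x ∈ xs × ¬ P x
  all-does-false⁻ xs e =
    find (¬All⇒Any¬ P? xs λ all-P →
      subst T e (all⁻ (does ∘ P?) (All.map (λ {x} → ≡true⇒T ∘ dec-true (P? x)) all-P)))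

  length-filter≥⇒All : ∀ {xs} → length xs ℕ.≤ length (filter P? xs) → All P xs
  length-filter≥⇒All {xs} filter-keeps-all = All.tabulate λ {x} x∈xs →
    decidable-stable (P? x) λ ¬Px →
      ℕₚ.<-irrefl refl (ℕₚ.<-≤-trans (filter-notAll P? xs (lose x∈xs ¬Px)) filter-keeps-all)

x+x+x≡3*x : ∀ x → x + x + x ≡ (1ℚ + 1ℚ + 1ℚ) * x
x+x+x≡3*x x = sym (begin
  (1ℚ + 1ℚ + 1ℚ) * x          ≡⟨ ℚₚ.*-distribʳ-+ x (1ℚ + 1ℚ) 1ℚ ⟩
  (1ℚ + 1ℚ) * x + 1ℚ * x      ≡⟨ cong (_+ 1ℚ * x) (ℚₚ.*-distribʳ-+ x 1ℚ 1ℚ) ⟩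
  1ℚ * x + 1ℚ * x + 1ℚ * x    ≡⟨ cong₂ _+_ (cong₂ _+_ 1x≡x 1x≡x) 1x≡x ⟩
  x + x + x                   ∎)
  where
  open ≡-Reasoning
  1x≡x : 1ℚ * x ≡ x
  1x≡x = ℚₚ.*-identityˡ x

module _ {n m : ℕ} (d : Fin n → Fin n → ℚ) (g : Fin n → Fin m) (k : Fin m → ℕ) where
  open FairKCenter d g k

  ∈ˢ⇒∈ : ∀ S {x} → x ∈ˢ S → x Sub.∈ S
  ∈ˢ⇒∈ S = lookup⇒[]= _ S

  ∈⇒∈ˢ : ∀ {S x} → x Sub.∈ S → x ∈ˢ S
  ∈⇒∈ˢ = []=⇒lookup

  ∈X : ∀ x → x ∈ˢ X
  ∈X = lookup∘tabulate _

  ∈-group⁺ : ∀ {x j} → g x ≡ j → x Sub.∈ group j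
  ∈-group⁺ {x} {j} gx≡j = ∈ˢ⇒∈ (group j) (trans (lookup∘tabulate _ x) (dec-true (g x ≟ j) gx≡j))

  ∈-group⁻ : ∀ {x j} → x Sub.∈ group j → g x ≡ j
  ∈-group⁻ {x} {j} x∈ = does-true⁻ (g x ≟ j) (trans (sym (lookup∘tabulate _ x)) (∈⇒∈ˢ x∈))

  IsMinDist-unique : ∀ A {b c c′} → IsMinDist A b c → IsMinDist A b c′ → c ≡ c′
  IsMinDist-unique _ ((a , a∈A , refl) , c≤) ((a′ , a′∈A , refl) , c′≤) =
    ℚₚ.≤-antisym (c≤ a′ a′∈A) (c′≤ a a∈A)

  -- Opaque because only the specification matters, and unfolding the argmin inside
  -- later unification problems makes type checking blow up.
  opaque
    ∃-IsMinDist : ∀ A {a₀} → a₀ ∈ˢ A → ∀ b → ∃ (IsMinDist A b)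
    ∃-IsMinDist A a₀∈A b =
      let a , a∈A , a-min = minimiser (λ a → d a b) (∈ˢ⇒∈ A a₀∈A)
      in d a b , (a , ∈⇒∈ˢ a∈A , refl) , λ a′ a′∈A → a-min (∈ˢ⇒∈ A a′∈A)

  ∃-IsCost : ∀ A B {a₀ b₀} → a₀ ∈ˢ A → b₀ ∈ˢ B → ∃ (IsCost A B)
  ∃-IsCost A B a₀∈A b₀∈B =
    let b , b∈B , b-max = maximiser (proj₁ ∘ ∃-IsMinDist A a₀∈A) (∈ˢ⇒∈ B b₀∈B)
        c , c-min       = ∃-IsMinDist A a₀∈A b
    in c , (b , ∈⇒∈ˢ b∈B , c-min) , λ b′ b′∈B c′ c′-min →
         subst (_≤ c) (IsMinDist-unique A (proj₂ (∃-IsMinDist A a₀∈A b′)) c′-min)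
               (b-max (∈ˢ⇒∈ B b′∈B))

  cost⇒covering : ∀ A B {c b} → IsCost A B c → b ∈ˢ B → ∃ λ a → a ∈ˢ A × d a b ≤ c
  cost⇒covering A B {b = b} ((_ , _ , (_ , a₀∈A , _) , _) , c-max) b∈B
    with ∃-IsMinDist A a₀∈A b
  ... | c′ , (a , a∈A , refl) , c′-min = a , a∈A , c-max b b∈B c′ ((a , a∈A , refl) , c′-min)

  covering⇒cost≤ : ∀ A B {c r} → IsCost A B c →
                   (∀ b → b ∈ˢ B → ∃ λ a → a ∈ˢ A × d a b ≤ r) → c ≤ r
  covering⇒cost≤ A B ((b , b∈B , _ , c-min) , _) covering with covering b b∈B
  ... | a , a∈A , dab≤r = ℚₚ.≤-trans (c-min a a∈A) dab≤r

  toSubset-map-feasible :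
    ∀ {s y : Fin n → Fin n} (P : List (Fin n)) (S : Subset n) →
    AllPairs (λ p q → s p ≢ s q) P → (∀ {q} → q ∈ P → s q ∈ˢ S) →
    (∀ {q} → q ∈ P → g (y q) ≡ g (s q)) → Feasible S → Feasible (toSubset (map y P))
  toSubset-map-feasible {s} {y} P S s-injective s∈S same-group S-feasible j = begin
    ∣ toSubset (map y P) ∩ group j ∣  ≤⟨ p⊆xs⇒∣p∣≤length (map y Pⱼ) ⊆map-y-Pⱼ ⟩
    length (map y Pⱼ)                 ≡⟨ length-map y Pⱼ ⟩
    length Pⱼ                         ≡⟨ length-map s Pⱼ ⟨
    length (map s Pⱼ)                 ≤⟨ xs⊆p⇒length≤∣p∣ s[Pⱼ]-unique map-s-Pⱼ⊆ ⟩
    ∣ S ∩ group j ∣                   ≤⟨ S-feasible j ⟩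
    k j                               ∎
    where
    open ℕₚ.≤-Reasoning
    y∈group? : Decidable (λ q → g (y q) ≡ j)
    y∈group? q = g (y q) ≟ j
    Pⱼ : List (Fin n)
    Pⱼ = filter y∈group? P
    ⊆map-y-Pⱼ : ∀ {x} → x Sub.∈ toSubset (map y P) ∩ group j → x ∈ map y Pⱼ
    ⊆map-y-Pⱼ x∈ with x∈p∩q⁻ _ _ x∈
    ... | x∈image , x∈group with ∈-map⁻ y (∈-toSubset⁻ (map y P) x∈image)
    ...   | q , q∈P , refl = ∈-map⁺ y (∈-filter⁺ y∈group? q∈P (∈-group⁻ x∈group))
    s[Pⱼ]-unique : Unique (map s Pⱼ)
    s[Pⱼ]-unique = AllPairs.map⁺ (AllPairs.filter⁺ y∈group? s-injective)
    map-s-Pⱼ⊆ : ∀ {x} → x ∈ map s Pⱼ → x Sub.∈ S ∩ group j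
    map-s-Pⱼ⊆ x∈ with ∈-map⁻ s x∈
    ... | q , q∈Pⱼ , refl with ∈-filter⁻ y∈group? q∈Pⱼ
    ...   | q∈P , gyq≡j = x∈p∩q⁺ (∈ˢ⇒∈ S (s∈S q∈P) , ∈-group⁺ (trans (sym (same-group q∈P)) gyq≡j))

  Separated : ℚ → List (Fin n) → Set
  Separated r = AllPairs (λ p q → r < d p q)

  module _ (τ : ℚ) where

    pass1-go-separated : ∀ P qs → Separated (τ + τ) P → Separated (τ + τ) (pass1-go τ P qs)
    pass1-go-separated P []       P-sep = P-sep
    pass1-go-separated P (q ∷ qs) P-sep with farFrom τ P q in far
    ... | true  = pass1-go-separated (P ++ q ∷ []) qs (AllPairs.++⁺ P-sep ([] ∷ []) P-far-q)
      where
      P-far-q : All (λ p → All (λ r → τ + τ < d p r) (q ∷ [])) P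
      P-far-q = All.map (_∷ []) (all-does⁻ (λ p → τ + τ <? d p q) P far)
    ... | false = pass1-go-separated P qs P-sep

    pass1-separated : ∀ σ → Separated (τ + τ) (pass1 τ σ)
    pass1-separated []      = []
    pass1-separated (x ∷ σ) = pass1-go-separated (x ∷ []) σ ([] ∷ [])

    pass1-go-⊇ : ∀ P qs {x} → x ∈ P → x ∈ pass1-go τ P qs
    pass1-go-⊇ P []       x∈P = x∈P
    pass1-go-⊇ P (q ∷ qs) x∈P with farFrom τ P q
    ... | true  = pass1-go-⊇ (P ++ q ∷ []) qs (∈-++⁺ˡ x∈P)
    ... | false = pass1-go-⊇ P qs x∈P

    -- The case splits are on `does (d q x ≤? τ)`, not on the decision itself: the latter
    -- unfolds in the goal, so a `with` on it would abstract nothing.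
    module _ (q : Fin n) where

      pass2-go-⊇ : ∀ acc xs {y} → y ∈ acc → y ∈ pass2-go τ q acc xs
      pass2-go-⊇ acc []       y∈acc = y∈acc
      pass2-go-⊇ acc (x ∷ xs) y∈acc with does (d q x ≤? τ) | hasGroup acc (g x)
      ... | true  | false = pass2-go-⊇ (acc ++ x ∷ []) xs (∈-++⁺ˡ y∈acc)
      ... | true  | true  = pass2-go-⊇ acc xs y∈acc
      ... | false | _     = pass2-go-⊇ acc xs y∈acc

      pass2-go-close : ∀ acc xs → All (λ y → d q y ≤ τ) acc →
                       All (λ y → d q y ≤ τ) (pass2-go τ q acc xs)
      pass2-go-close acc []       acc-close = acc-close
      pass2-go-close acc (x ∷ xs) acc-close with does (d q x ≤? τ) in close | hasGroup acc (g x)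
      ... | true  | false = pass2-go-close (acc ++ x ∷ []) xs
                              (All.++⁺ acc-close (does-true⁻ (d q x ≤? τ) close ∷ []))
      ... | true  | true  = pass2-go-close acc xs acc-close
      ... | false | _     = pass2-go-close acc xs acc-close

      pass2-go-meets-group : ∀ acc xs {z} → z ∈ xs → d q z ≤ τ →
                             ∃ λ y → y ∈ pass2-go τ q acc xs × g y ≡ g z
      pass2-go-meets-group acc (x ∷ xs) (here refl) qx≤τ
        with does (d q x ≤? τ) in close | hasGroup acc (g x) in has
      ... | true  | false = x , pass2-go-⊇ (acc ++ x ∷ []) xs (∈-++⁺ʳ acc (here refl)) , refl
      ... | true  | true with any-does⁻ (λ y → g y ≟ g x) acc has
      ...   | y , y∈acc , gy≡gx = y , pass2-go-⊇ acc xs y∈acc , gy≡gx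
      pass2-go-meets-group acc (x ∷ xs) (here refl) qx≤τ | false | _
        with () ← trans (sym close) (dec-true (d q x ≤? τ) qx≤τ)
      pass2-go-meets-group acc (x ∷ xs) (there z∈xs) qz≤τ
        with does (d q x ≤? τ) | hasGroup acc (g x)
      ... | true  | false = pass2-go-meets-group (acc ++ x ∷ []) xs z∈xs qz≤τ
      ... | true  | true  = pass2-go-meets-group acc xs z∈xs qz≤τ
      ... | false | _     = pass2-go-meets-group acc xs z∈xs qz≤τ

module _ {n m : ℕ} (d : Fin n → Fin n → ℚ) (metric : IsMetric d)
         (g : Fin n → Fin m) (k : Fin m → ℕ) where
  open FairKCenter d g k
  open IsMetric metric

  d[x,x]≤ : ∀ {r} x → 0ℚ ≤ r → d x x ≤ r
  d[x,x]≤ x = subst (_≤ _) (sym (refl0 x))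

  cost-nonneg : ∀ A B {c} → IsCost A B c → 0ℚ ≤ c
  cost-nonneg _ _ ((b , _ , (a , _ , refl) , _) , _) = nonneg a b

  module _ {τ : ℚ} (0≤τ : 0ℚ ≤ τ) where

    0≤τ+τ : 0ℚ ≤ τ + τ
    0≤τ+τ = ℚₚ.+-mono-≤ 0≤τ 0≤τ

    pass1-go-covers : ∀ P qs {x} → x ∈ qs → ∃ λ p → p ∈ pass1-go τ P qs × d p x ≤ τ + τ
    pass1-go-covers P (q ∷ qs) (here refl) with farFrom τ P q in far
    ... | true  = q , pass1-go-⊇ d g k τ (P ++ q ∷ []) qs (∈-++⁺ʳ P (here refl)) , d[x,x]≤ q 0≤τ+τ
    ... | false with all-does-false⁻ (λ p → τ + τ <? d p q) P far
    ...   | p , p∈P , p-near-q = p , pass1-go-⊇ d g k τ P qs p∈P , ℚₚ.≮⇒≥ p-near-q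
    pass1-go-covers P (q ∷ qs) (there x∈qs) with farFrom τ P q
    ... | true  = pass1-go-covers (P ++ q ∷ []) qs x∈qs
    ... | false = pass1-go-covers P qs x∈qs

    pass1-covers : ∀ σ {x} → x ∈ σ → ∃ λ p → p ∈ pass1 τ σ × d p x ≤ τ + τ
    pass1-covers (x ∷ σ) (here refl) =
      x , pass1-go-⊇ d g k τ (x ∷ []) σ (here refl) , d[x,x]≤ x 0≤τ+τ
    pass1-covers (_ ∷ σ) (there x∈σ) = pass1-go-covers (_ ∷ []) σ x∈σ

    N-close : ∀ σ q {y} → y ∈ N τ σ q → d q y ≤ τ
    N-close σ q = All.lookup (pass2-go-close d g k τ q (q ∷ []) σ (d[x,x]≤ q 0≤τ ∷ []))

  module _ {τ : ℚ} {σ₁ σ₂ : List (Fin n)} (σ₁↭ : σ₁ ↭ allFin n) (σ₂↭ : σ₂ ↭ allFin n) where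

    private
      P : List (Fin n)
      P = pass1 τ σ₁

      Nq : Fin n → List (Fin n)
      Nq = N τ σ₂

      ∈σ₁ : ∀ x → x ∈ σ₁
      ∈σ₁ x = ∈-resp-↭ (↭-sym σ₁↭) (∈-allFin x)

      ∈σ₂ : ∀ x → x ∈ σ₂
      ∈σ₂ x = ∈-resp-↭ (↭-sym σ₂↭) (∈-allFin x)

    MeetsN : Subset n → Fin n → Set
    MeetsN S q = any (lookup S) (Nq q) ≡ true

    meetsN? : ∀ S → Decidable (MeetsN S)
    meetsN? S q = any (lookup S) (Nq q) Bool.≟ true

    module _ (S* : Subset n) (S*-feasible : Feasible S*)
             (S*-covers : ∀ q → ∃ λ a → a ∈ˢ S* × d a q ≤ τ) where

      private
        s : Fin n → Fin n
        s q = proj₁ (S*-covers q)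

        s∈S* : ∀ q → s q ∈ˢ S*
        s∈S* q = proj₁ (proj₂ (S*-covers q))

        s-near : ∀ q → d (s q) q ≤ τ
        s-near q = proj₂ (proj₂ (S*-covers q))

        q-near-s : ∀ q → d q (s q) ≤ τ
        q-near-s q = subst (_≤ τ) (symm (s q) q) (s-near q)

        far⇒s-distinct : ∀ {p q} → τ + τ < d p q → s p ≢ s q
        far⇒s-distinct {p} {q} p-far-q sp≡sq = ℚₚ.<-irrefl refl (ℚₚ.<-≤-trans p-far-q (begin
          d p q                  ≤⟨ triangle p (s p) q ⟩
          d p (s p) + d (s p) q  ≤⟨ ℚₚ.+-mono-≤ (q-near-s p) sp-near-q ⟩
          τ + τ                  ∎))
          where
          open ℚₚ.≤-Reasoning
          sp-near-q : d (s p) q ≤ τ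
          sp-near-q = subst (λ a → d a q ≤ τ) (sym sp≡sq) (s-near q)

        s-injective : AllPairs (λ p q → s p ≢ s q) P
        s-injective = AllPairs.map far⇒s-distinct (pass1-separated d g k τ σ₁)

        representative : ∀ q → ∃ λ y → y ∈ Nq q × g y ≡ g (s q)
        representative q = pass2-go-meets-group d g k τ q (q ∷ []) σ₂ (∈σ₂ (s q)) (q-near-s q)

        y : Fin n → Fin n
        y q = proj₁ (representative q)

        y∈N : ∀ q → y q ∈ Nq q
        y∈N q = proj₁ (proj₂ (representative q))

        same-group : ∀ q → g (y q) ≡ g (s q)
        same-group q = proj₂ (proj₂ (representative q))

        S′ : Subset n
        S′ = toSubset (map y P)

        S′⊆N : ⊆Union P Nq S′
        S′⊆N x x∈S′ with ∈-map⁻ y (∈-toSubset⁻ (map y P) (∈ˢ⇒∈ d g k S′ x∈S′))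
        ... | q , q∈P , refl = q , q∈P , y∈N q

        S′-meets-all : All (MeetsN S′) P
        S′-meets-all = All.tabulate λ {q} q∈P →
          any≡true⁺ (lookup S′) (y∈N q) (∈⇒∈ˢ d g k (∈-toSubset⁺ (∈-map⁺ y q∈P)))

      feasible-set-meeting-every-N : ∃ λ S′ → Feasible S′ × ⊆Union P Nq S′ × All (MeetsN S′) P
      feasible-set-meeting-every-N =
        S′ ,
        toSubset-map-feasible d g k P S* s-injective (λ {q} _ → s∈S* q) (λ {q} _ → same-group q)
                              S*-feasible ,
        S′⊆N , S′-meets-all

    module _ {opt : ℚ} (opt-is-OPT : IsOPT opt) (opt≤τ : opt ≤ τ) where

      private
        0≤τ : 0ℚ ≤ τ
        0≤τ = let S* , _ , S*-cost = proj₁ opt-is-OPT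
              in ℚₚ.≤-trans (cost-nonneg S* X S*-cost) opt≤τ

      feasible-τ-cover : ∃ λ S* → Feasible S* × ∀ q → ∃ λ a → a ∈ˢ S* × d a q ≤ τ
      feasible-τ-cover =
        let S* , S*-feasible , S*-cost = proj₁ opt-is-OPT
        in S* , S*-feasible , λ q →
             let a , a∈S* , daq≤opt = cost⇒covering d g k S* X S*-cost (∈X d g k q)
             in a , a∈S* , ℚₚ.≤-trans daq≤opt opt≤τ

      output-meets-every-N : ∀ S → IsOutput P Nq S → All (MeetsN S) P
      output-meets-every-N S (_ , _ , S-maximal) =
        let S* , S*-feasible , S*-covers = feasible-τ-cover
            S′ , S′-feasible , S′⊆N , S′-meets-all =
              feasible-set-meeting-every-N S* S*-feasible S*-covers
            S′-hits-all = cong length (filter-all (meetsN? S′) S′-meets-all)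
        in length-filter≥⇒All (meetsN? S)
             (subst (ℕ._≤ hits P Nq S) S′-hits-all (S-maximal S′ S′-feasible S′⊆N))

      output-covers : ∀ S → IsOutput P Nq S → ∀ b → ∃ λ a → a ∈ˢ S × d a b ≤ τ + τ + τ
      output-covers S out b =
        let p , p∈P , dpb≤2τ = pass1-covers 0≤τ σ₁ (∈σ₁ b)
            a , a∈Np , a∈S   =
              any≡true⁻ (lookup S) (Nq p) (All.lookup (output-meets-every-N S out) p∈P)
            dap≤τ = subst (_≤ τ) (symm p a) (N-close 0≤τ σ₂ p a∈Np)
        in a , a∈S , (begin
          d a b         ≤⟨ triangle a p b ⟩
          d a p + d p b ≤⟨ ℚₚ.+-mono-≤ dap≤τ dpb≤2τ ⟩
          τ + (τ + τ)   ≡⟨ ℚₚ.+-assoc τ τ τ ⟨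
          τ + τ + τ     ∎)
        where open ℚₚ.≤-Reasoning

      output-cost≤3τ : ∀ S → IsOutput P Nq S → ∃ λ c → IsCost S X c × c ≤ τ + τ + τ
      output-cost≤3τ S out =
        -- IsCost needs a point of X; the optimal solution's cost provides one.
        let _ , _ , (b₀ , _) , _ = proj₁ opt-is-OPT
            _ , b₀-covered , _   = output-covers S out b₀
            c , c-cost           = ∃-IsCost d g k S X b₀-covered (∈X d g k b₀)
        in c , c-cost , covering⇒cost≤ d g k S X c-cost (λ b _ → output-covers S out b)

theorem1 : ∀ {n m : ℕ} (d : Fin n → Fin n → ℚ) → IsMetric d →
           (g : Fin n → Fin m) (k : Fin m → ℕ) →
           (opt : ℚ) → FairKCenter.IsOPT d g k opt →
           (τ : ℚ) → opt ≤ τ →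
           (σ₁ σ₂ : List (Fin n)) → σ₁ ↭ allFin n → σ₂ ↭ allFin n →
           (S : Subset n) →
           FairKCenter.IsOutput d g k (FairKCenter.pass1 d g k τ σ₁)
             (FairKCenter.N d g k τ σ₂) S →
           FairKCenter.Feasible d g k S
           × (∃ λ c → FairKCenter.IsCost d g k S (FairKCenter.X d g k) c
               × c ≤ τ + τ + τ
               × (∀ (ε : ℚ) → 0ℚ < ε → τ ≤ (1ℚ + ε) * opt →
                    c ≤ (1ℚ + 1ℚ + 1ℚ) * ((1ℚ + ε) * opt)))
theorem1 d metric g k opt opt-is-OPT τ opt≤τ σ₁ σ₂ σ₁↭ σ₂↭ S out =
  let c , c-cost , c≤3τ = output-cost≤3τ d metric g k σ₁↭ σ₂↭ opt-is-OPT opt≤τ S out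
  in proj₁ out , c , c-cost , c≤3τ , λ ε _ τ≤r → begin
    c                                                   ≤⟨ c≤3τ ⟩
    τ + τ + τ                                           ≤⟨ ℚₚ.+-mono-≤ (ℚₚ.+-mono-≤ τ≤r τ≤r) τ≤r ⟩
    (1ℚ + ε) * opt + (1ℚ + ε) * opt + (1ℚ + ε) * opt    ≡⟨ x+x+x≡3*x ((1ℚ + ε) * opt) ⟩
    (1ℚ + 1ℚ + 1ℚ) * ((1ℚ + ε) * opt)                   ∎
  where open ℚₚ.≤-Reasoning
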